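{- Let \[ b_n=\frac{q^{\nu+n+1}}{1-q^{\nu+n+1}},\qquad a_n =\frac{q^{2\nu+2n+1}}{(1-q^{\nu+n})(1-q^{\nu+n+1})} ,\qquad \lambda_n =0, \] \[ b'_n=a'_n=0, \qquad \lambda'_{2i} = \frac{q^{2\nu+3i+1}}{(1-q^{\nu+2i})(1-q^{\nu+2i+1})}, \qquad \lambda'_{2i+1} = \frac{q^{\nu+i+1}}{(1-q^{\nu+2i+1})(1-q^{\nu+2i+2})}. \] Then \[ \frac{J_{\nu+1}(z;q^{ -1})}{J_{\nu}(z;q^{ -1})} = \frac{q^{\nu+1}z}{q^{\nu+1}-1} \sum_{n\ge0}\mu_n(b,a,\lambda) z^{2n} = \frac{q^{\nu+1}z}{q^{\nu+1}-1} \sum_{n\ge0}\mu_{2n}(b',a',\lambda') z^{2n}. \]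
   Context: For sequences $b,a,\lambda$, $\mu_n(b,a,\lambda)$ are the coefficients of the formal power series in $t$ given by $\sum_{n\ge0}\mu_n t^n=\cfrac{1}{1-b_0t-\cfrac{a_1t+\lambda_1t^2}{1-b_1t-\cfrac{a_2t+\lambda_2t^2}{1-b_2t-\cdots}}}$. With $(x;p)_n=\prod_{i=0}^{n-1}(1-xp^i)$, the Hahn–Exton ratio with base $p=q^{ -1}$ is the formal power series $\frac{J_{\nu+1}(w;p)}{J_\nu(w;p)}=\frac{w}{1-p^{\nu+1}}\frac{\Phi_{\nu+1}(w;p)}{\Phi_\nu(w;p)}$, $\Phi_\nu(w;p)=\sum_{n\ge0}\frac{(-1)^np^{\binom n2}(pw^2)^n}{(p;p)_n(p^{\nu+1};p)_n}$ (coming from $J_\nu(w;p)=\frac{(p^{\nu+1};p)_\infty w^\nu}{(p;p)_\infty}\Phi_\nu(w;p)$). -}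

module Defs where

open import Level using (Level; _⊔_) renaming (suc to lsuc)
open import Algebra.Bundles using (CommutativeRing)
open import Data.Nat as ℕ using (ℕ; zero; suc; _∸_)
open import Data.Nat.Combinatorics using (_C_)
open import Relation.Nullary using (¬_)

record Field c ℓ : Set (lsuc (c ⊔ ℓ)) where
  field
    commutativeRing : CommutativeRing c ℓ
  open CommutativeRing commutativeRing public
  field
    _⁻¹       : Carrier → Carrier
    0≉1       : ¬ (0# ≈ 1#)
    ⁻¹-inverse : ∀ x → ¬ (x ≈ 0#) → x * (x ⁻¹) ≈ 1#

module Setup {c ℓ} (F : Field c ℓ) where
  open Field F

  infixr 8 _^_
  _^_ : Carrier → ℕ → Carrier
  x ^ zero  = 1#
  x ^ suc n = x * (x ^ n)

  sumTo : ℕ → (ℕ → Carrier) → Carrier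
  sumTo zero    f = f 0
  sumTo (suc n) f = sumTo n f + f (suc n)

  prodBelow : ℕ → (ℕ → Carrier) → Carrier
  prodBelow zero    f = 1#
  prodBelow (suc n) f = prodBelow n f * f n

  poch : Carrier → Carrier → ℕ → Carrier
  poch x p n = prodBelow n (λ i → 1# - x * (p ^ i))

  -- even/odd case split: evenOdd e o (2i) = e i, evenOdd e o (2i+1) = o i
  evenOdd : ∀ {a} {A : Set a} → (ℕ → A) → (ℕ → A) → ℕ → A
  evenOdd e o zero          = e 0
  evenOdd e o (suc zero)    = o 0
  evenOdd e o (suc (suc n)) = evenOdd (λ i → e (suc i)) (λ i → o (suc i)) n

  -- Formal power series (in one variable) as coefficient sequences.
  PS : Set c
  PS = ℕ → Carrier

  const : Carrier → PS
  const x zero    = x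
  const x (suc n) = 0#

  _⊕_ : PS → PS → PS
  (f ⊕ g) n = f n + g n

  _⊖_ : PS → PS → PS
  (f ⊖ g) n = f n - g n

  scale : Carrier → PS → PS
  scale x f n = x * f n

  _⊛_ : PS → PS → PS
  (f ⊛ g) n = sumTo n (λ k → f k * g (n ∸ k))

  -- multiplication by the variable
  shift : PS → PS
  shift f zero    = 0#
  shift f (suc n) = f n

  powPS : PS → ℕ → PS
  powPS f zero    = const 1#
  powPS f (suc m) = f ⊛ powPS f m

  -- reciprocal of a series with constant term 1:
  -- 1/f = 1/(1-h) = Σ_m h^m with h = 1 - f (h has zero constant term,
  -- so the n-th coefficient only involves m ≤ n)
  recip : PS → PS
  recip f n = sumTo n (λ m → powPS (const 1# ⊖ f) m n)

  -- substitution w ↦ w² : spread f (2n) = f n, spread f (2n+1) = 0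
  spread : PS → PS
  spread f = evenOdd f (λ _ → 0#)

  -- The J-fraction
  --   F_i = 1 / (1 - b_i t - (a_{i+1} t + λ_{i+1} t²) F_{i+1})
  -- truncated at depth d (F_{i+d} replaced by 1).
  cfApprox : ℕ → (b a lam : ℕ → Carrier) → ℕ → PS
  cfApprox zero    b a lam i = const 1#
  cfApprox (suc d) b a lam i =
    recip (const 1# ⊖ (shift (const (b i))
             ⊕ ((shift (const (a (suc i))) ⊕ shift (shift (const (lam (suc i)))))
                  ⊛ cfApprox d b a lam (suc i))))

  -- μ_n(b,a,λ): the n-th coefficient of the J-fraction; truncation at
  -- depth n+1 does not affect the coefficient of t^n.
  μ : (b a lam : ℕ → Carrier) → ℕ → Carrier
  μ b a lam n = cfApprox (suc n) b a lam 0 n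

  -- Hahn–Exton data.  Parameters: q and r, where r plays the role of q^ν.
  module HahnExton (q r : Carrier) where
    p : Carrier
    p = q ⁻¹

    -- p^{ν+1} = (q^{ν+1})⁻¹ = (q r)⁻¹
    pν1 : Carrier
    pν1 = (q * r) ⁻¹

    -- Φ as a series in x = w²;  s stands for p^{ν+1} (so Φ_ν uses s = pν1,
    -- Φ_{ν+1} uses s = p * pν1):
    -- coefficient n = (-1)^n p^{C(n,2)} p^n / ((p;p)_n (s;p)_n)
    ΦSeries : Carrier → PS
    ΦSeries s n = ((- 1#) ^ n) * (p ^ (n C 2)) * (p ^ n)
                  * (poch p p n ⁻¹) * (poch s p n ⁻¹)

    -- J_{ν+1}(w;p)/J_ν(w;p) = w/(1-p^{ν+1}) · Φ_{ν+1}(w;p)/Φ_ν(w;p), in w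
    JRatio : PS
    JRatio = scale ((1# - pν1) ⁻¹)
               (shift (spread (ΦSeries (p * pν1)) ⊛ recip (spread (ΦSeries pν1))))

    -- q^{ν+k} = q^k r
    qν : ℕ → Carrier
    qν k = (q ^ k) * r

    b : ℕ → Carrier
    b n = qν (suc n) * (1# - qν (suc n)) ⁻¹

    -- q^{2ν+2n+1} = r² q^{2n+1}
    a : ℕ → Carrier
    a n = (r * r) * (q ^ (suc (n ℕ.+ n)))
          * ((1# - qν n) * (1# - qν (suc n))) ⁻¹

    lam : ℕ → Carrier
    lam n = 0#

    b' : ℕ → Carrier
    b' n = 0#

    a' : ℕ → Carrier
    a' n = 0#

    lam' : ℕ → Carrier
    lam' = evenOdd
      (λ i → (r * r) * (q ^ suc (3 ℕ.* i))
               * ((1# - qν (2 ℕ.* i)) * (1# - qν (suc (2 ℕ.* i)))) ⁻¹)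
      (λ i → r * (q ^ suc i)
               * ((1# - qν (suc (2 ℕ.* i))) * (1# - qν (suc (suc (2 ℕ.* i))))) ⁻¹)

    -- prefactor q^{ν+1} z / (q^{ν+1} - 1) times Σ_n c_n z^{2n}
    rhs : (ℕ → Carrier) → PS
    rhs coeffs = scale ((q * r) * ((q * r) - 1#) ⁻¹) (shift (spread coeffs))

module Submission where

-- If series P₀, P₁, … with constant term 1 satisfy the three-term recurrence
--   P_k = (1 - b_k t) P_{k+1} - (a_{k+1} t + λ_{k+1} t²) P_{k+2},
-- then P_{k+1}/P_k = 1/(1 - b_k t - (a_{k+1} t + λ_{k+1} t²) P_{k+2}/P_{k+1}), so P₁/P₀ is
-- the J-fraction: its coefficient of tⁿ only depends on the first n+1 levels, where the
-- truncated fraction and the ratios agree.  For the first expansion P_k is Φ with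
-- p^(ν+1) replaced by p^(ν+1+k); for the second it is the same series in t² whose
-- variable is moreover rescaled by p at every second level.  Both recurrences are
-- contiguous relations of the q-Bessel coefficients: after clearing the common
-- denominator they are polynomial identities modulo q^(ν+k+1) p^(ν+k+1) = 1.

open import Defs
open import Data.Nat using (ℕ; suc)
open import Data.Product using (_×_)
open import Relation.Nullary using (¬_)

open import Algebra.Bundles using (CommutativeRing; RawRing)
open import Data.Nat.Base as ℕ using (zero; _∸_; _≤_; _<_; z≤n; s≤s)
import Data.Nat.Properties as ℕ
open import Data.Nat.Combinatorics using (_C_; nCk+nC[k+1]≡[n+1]C[k+1]; nC1≡n)
open import Data.Product.Base using (_,_)
open import Data.Product.Properties using (≡-dec)
open import Data.Maybe.Base using (Maybe; just; nothing)
open import Data.Sum.Base using (inj₁; inj₂)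
open import Data.Empty using (⊥-elim)
open import Relation.Nullary.Decidable using (yes; no)
open import Relation.Binary.PropositionalEquality as ≡ using (_≡_)
import Relation.Binary.Reasoning.Setoid

-- Ring solver with integer coefficients

-- Normal forms only cancel (x - x to 0) if coefficients can be compared, so the
-- coefficients are integers, represented by a pair (a , b) standing for a - b; the
-- ring operations keep one component zero, so equal integers are equal pairs.
ℤᵈ : Set
ℤᵈ = ℕ × ℕ

normalise : ℕ → ℕ → ℤᵈ
normalise a b = (a ∸ b , b ∸ a)

ℤᵈ-rawRing : RawRing _ _
ℤᵈ-rawRing = record
  { Carrier = ℤᵈ
  ; _≈_     = _≡_
  ; _+_     = λ { (a , b) (c , d) → normalise (a ℕ.+ c) (b ℕ.+ d) }
  ; _*_     = λ { (a , b) (c , d) → normalise (a ℕ.* c ℕ.+ b ℕ.* d) (a ℕ.* d ℕ.+ b ℕ.* c) }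
  ; -_      = λ { (a , b) → (b , a) }
  ; 0#      = (0 , 0)
  ; 1#      = (1 , 0)
  }

module IntegerCoefficientSolver {c ℓ} (R : CommutativeRing c ℓ) where
  open CommutativeRing R
  open import Algebra.Properties.Semiring.Mult.TCOptimised semiring
    using (1+×; ×-homo-+; ×1-homo-*) renaming (_×_ to _×ₙ_)
  open import Algebra.Properties.Ring ring
    using (-0#≈0#; -‿+-comm; ⁻¹-anti-homo‿-; -‿distribˡ-*; -‿distribʳ-*; -‿involutive)
  open import Algebra.Properties.CommutativeSemigroup +-commutativeSemigroup using (interchange)
  open import Algebra.Solver.Ring.AlmostCommutativeRing
    using (fromCommutativeRing; _-Raw-AlmostCommutative⟶_)
  open import Relation.Binary.Reasoning.Setoid setoid

  -- Chosen so that the constants (0 , 0) and (1 , 0) denote 0# and 1# on the nose,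
  -- which the solver needs to compare normal forms by refl.
  ⟦_⟧ : ℤᵈ → Carrier
  ⟦ (a , zero) ⟧  = a ×ₙ 1#
  ⟦ (a , suc b) ⟧ = a ×ₙ 1# - suc b ×ₙ 1#

  private
    -‿distrib-+ : ∀ x y → - (x + y) ≈ - x + - y
    -‿distrib-+ x y = sym (-‿+-comm x y)

    +-sub-+ : ∀ x y u v → (x + u) - (y + v) ≈ (x - y) + (u - v)
    +-sub-+ x y u v = trans (+-congˡ (-‿distrib-+ y v)) (interchange x u (- y) (- v))

    sub-cancelˡ : ∀ o x y → (o + x) - (o + y) ≈ x - y
    sub-cancelˡ o x y = begin
      (o + x) - (o + y) ≈⟨ +-sub-+ o o x y ⟩
      (o - o) + (x - y) ≈⟨ +-congʳ (-‿inverseʳ o) ⟩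
      0# + (x - y)      ≈⟨ +-identityˡ _ ⟩
      x - y             ∎

    sub-*-sub : ∀ x y u v → (x * u + y * v) - (x * v + y * u) ≈ (x - y) * (u - v)
    sub-*-sub x y u v = sym (begin
      (x - y) * (u - v)                         ≈⟨ distribʳ _ _ _ ⟩
      x * (u - v) + - y * (u - v)               ≈⟨ +-cong (distribˡ _ _ _) (distribˡ _ _ _) ⟩
      (x * u + x * - v) + (- y * u + - y * - v) ≈⟨ +-cong (+-congˡ (sym (-‿distribʳ-* x v)))
                                                    (+-cong (sym (-‿distribˡ-* y u)) neg*neg) ⟩
      (x * u - x * v) + (- (y * u) + y * v)     ≈⟨ +-congˡ (+-comm _ _) ⟩
      (x * u - x * v) + (y * v - y * u)         ≈⟨ interchange _ _ _ _ ⟩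
      (x * u + y * v) + (- (x * v) + - (y * u)) ≈⟨ +-congˡ (-‿distrib-+ _ _) ⟨
      (x * u + y * v) - (x * v + y * u)         ∎)
      where
      neg*neg : - y * - v ≈ y * v
      neg*neg = trans (sym (-‿distribˡ-* y (- v)))
                      (trans (-‿cong (sym (-‿distribʳ-* y v))) (-‿involutive _))

  ⟦⟧-difference : ∀ a b → ⟦ (a , b) ⟧ ≈ a ×ₙ 1# - b ×ₙ 1#
  ⟦⟧-difference a zero    = sym (trans (+-congˡ -0#≈0#) (+-identityʳ _))
  ⟦⟧-difference a (suc b) = refl

  ⟦normalise⟧ : ∀ a b → ⟦ normalise a b ⟧ ≈ a ×ₙ 1# - b ×ₙ 1#
  ⟦normalise⟧ zero    zero    = ⟦⟧-difference 0 0
  ⟦normalise⟧ zero    (suc b) = refl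
  ⟦normalise⟧ (suc a) zero    = ⟦⟧-difference (suc a) 0
  ⟦normalise⟧ (suc a) (suc b) = begin
    ⟦ normalise a b ⟧                 ≈⟨ ⟦normalise⟧ a b ⟩
    a ×ₙ 1# - b ×ₙ 1#                 ≈⟨ sub-cancelˡ 1# (a ×ₙ 1#) (b ×ₙ 1#) ⟨
    (1# + a ×ₙ 1#) - (1# + b ×ₙ 1#)   ≈⟨ +-cong (1+× a 1#) (-‿cong (1+× b 1#)) ⟨
    suc a ×ₙ 1# - suc b ×ₙ 1#         ∎

  ⟦⟧-homomorphism : ℤᵈ-rawRing -Raw-AlmostCommutative⟶ fromCommutativeRing R
  ⟦⟧-homomorphism = record
    { ⟦_⟧    = ⟦_⟧
    ; +-homo = λ { (a , b) (c , d) → begin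
        ⟦ normalise (a ℕ.+ c) (b ℕ.+ d) ⟧           ≈⟨ ⟦normalise⟧ (a ℕ.+ c) (b ℕ.+ d) ⟩
        (a ℕ.+ c) ×ₙ 1# - (b ℕ.+ d) ×ₙ 1#           ≈⟨ +-cong (×-homo-+ 1# a c) (-‿cong (×-homo-+ 1# b d)) ⟩
        (a ×ₙ 1# + c ×ₙ 1#) - (b ×ₙ 1# + d ×ₙ 1#)   ≈⟨ +-sub-+ _ _ _ _ ⟩
        (a ×ₙ 1# - b ×ₙ 1#) + (c ×ₙ 1# - d ×ₙ 1#)   ≈⟨ +-cong (⟦⟧-difference a b) (⟦⟧-difference c d) ⟨
        ⟦ (a , b) ⟧ + ⟦ (c , d) ⟧                   ∎ }
    ; *-homo = λ { (a , b) (c , d) → begin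
        ⟦ normalise (a ℕ.* c ℕ.+ b ℕ.* d) (a ℕ.* d ℕ.+ b ℕ.* c) ⟧
          ≈⟨ ⟦normalise⟧ (a ℕ.* c ℕ.+ b ℕ.* d) (a ℕ.* d ℕ.+ b ℕ.* c) ⟩
        (a ℕ.* c ℕ.+ b ℕ.* d) ×ₙ 1# - (a ℕ.* d ℕ.+ b ℕ.* c) ×ₙ 1#
          ≈⟨ +-cong (×-homo-+* a c b d) (-‿cong (×-homo-+* a d b c)) ⟩
        (a ×ₙ 1# * (c ×ₙ 1#) + b ×ₙ 1# * (d ×ₙ 1#)) - (a ×ₙ 1# * (d ×ₙ 1#) + b ×ₙ 1# * (c ×ₙ 1#))
          ≈⟨ sub-*-sub _ _ _ _ ⟩
        (a ×ₙ 1# - b ×ₙ 1#) * (c ×ₙ 1# - d ×ₙ 1#)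
          ≈⟨ *-cong (⟦⟧-difference a b) (⟦⟧-difference c d) ⟨
        ⟦ (a , b) ⟧ * ⟦ (c , d) ⟧ ∎ }
    ; -‿homo = λ { (a , b) → begin
        ⟦ (b , a) ⟧           ≈⟨ ⟦⟧-difference b a ⟩
        b ×ₙ 1# - a ×ₙ 1#     ≈⟨ ⁻¹-anti-homo‿- (a ×ₙ 1#) (b ×ₙ 1#) ⟨
        - (a ×ₙ 1# - b ×ₙ 1#) ≈⟨ -‿cong (⟦⟧-difference a b) ⟨
        - ⟦ (a , b) ⟧         ∎ }
    ; 0-homo = refl
    ; 1-homo = refl
    }
    where
    ×-homo-+* : ∀ a c b d → (a ℕ.* c ℕ.+ b ℕ.* d) ×ₙ 1# ≈ a ×ₙ 1# * (c ×ₙ 1#) + b ×ₙ 1# * (d ×ₙ 1#)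
    ×-homo-+* a c b d = trans (×-homo-+ 1# (a ℕ.* c) (b ℕ.* d)) (+-cong (×1-homo-* a c) (×1-homo-* b d))

  _≟ᶜ_ : ∀ x y → Maybe (⟦ x ⟧ ≈ ⟦ y ⟧)
  x ≟ᶜ y with ≡-dec ℕ._≟_ ℕ._≟_ x y
  ... | yes ≡.refl = just refl
  ... | no _       = nothing

  open import Algebra.Solver.Ring ℤᵈ-rawRing (fromCommutativeRing R) ⟦⟧-homomorphism _≟ᶜ_ public
    using (Polynomial; solve; _:=_; _:+_; _:*_; _:-_; :-_; con)

  :0 :1 : ∀ {n} → Polynomial n
  :0 = con (0 , 0)
  :1 = con (1 , 0)

module _ {c ℓ} (F : Field c ℓ) where
  open Field F
  open Setup F
  open IntegerCoefficientSolver commutativeRing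
  open import Algebra.Properties.Ring ring using (-0#≈0#; x≈y⇒x∙y⁻¹≈ε; x∙y⁻¹≈ε⇒x≈y)

  module ≈-Reasoning = Relation.Binary.Reasoning.Setoid setoid

  ≡⇒≈ : ∀ {x y} → x ≡ y → x ≈ y
  ≡⇒≈ ≡.refl = refl

  sumTo-cong≤ : ∀ n {f g : ℕ → Carrier} → (∀ k → k ≤ n → f k ≈ g k) → sumTo n f ≈ sumTo n g
  sumTo-cong≤ zero    f≈g = f≈g 0 z≤n
  sumTo-cong≤ (suc n) f≈g = +-cong (sumTo-cong≤ n (λ k k≤n → f≈g k (ℕ.m≤n⇒m≤1+n k≤n))) (f≈g (suc n) ℕ.≤-refl)

  sumTo-cong : ∀ n {f g : ℕ → Carrier} → (∀ k → f k ≈ g k) → sumTo n f ≈ sumTo n g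
  sumTo-cong n f≈g = sumTo-cong≤ n (λ k _ → f≈g k)

  sumTo-zero : ∀ n (f : ℕ → Carrier) → (∀ k → k ≤ n → f k ≈ 0#) → sumTo n f ≈ 0#
  sumTo-zero zero    f f≈0 = f≈0 0 z≤n
  sumTo-zero (suc n) f f≈0 =
    trans (+-cong (sumTo-zero n f (λ k k≤n → f≈0 k (ℕ.m≤n⇒m≤1+n k≤n))) (f≈0 (suc n) ℕ.≤-refl)) (+-identityʳ 0#)

  sumTo-+ : ∀ n (f g : ℕ → Carrier) → sumTo n (λ k → f k + g k) ≈ sumTo n f + sumTo n g
  sumTo-+ zero    f g = refl
  sumTo-+ (suc n) f g = trans (+-congʳ (sumTo-+ n f g)) (interchange _ _ _ _)
    where open import Algebra.Properties.CommutativeSemigroup +-commutativeSemigroup using (interchange)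

  sumTo-*ˡ : ∀ n x (f : ℕ → Carrier) → sumTo n (λ k → x * f k) ≈ x * sumTo n f
  sumTo-*ˡ zero    x f = refl
  sumTo-*ˡ (suc n) x f = trans (+-congʳ (sumTo-*ˡ n x f)) (sym (distribˡ x _ _))

  sumTo-*ʳ : ∀ n x (f : ℕ → Carrier) → sumTo n (λ k → f k * x) ≈ sumTo n f * x
  sumTo-*ʳ n x f = trans (sumTo-cong n (λ k → *-comm _ _)) (trans (sumTo-*ˡ n x f) (*-comm _ _))

  sumTo-sucˡ : ∀ n (f : ℕ → Carrier) → sumTo (suc n) f ≈ f 0 + sumTo n (λ k → f (suc k))
  sumTo-sucˡ zero    f = refl
  sumTo-sucˡ (suc n) f = trans (+-congʳ (sumTo-sucˡ n f)) (+-assoc _ _ _)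

  sumTo-reverse : ∀ n (f : ℕ → Carrier) → sumTo n f ≈ sumTo n (λ k → f (n ∸ k))
  sumTo-reverse zero    f = refl
  sumTo-reverse (suc n) f = begin
    sumTo n f + f (suc n)                  ≈⟨ +-congʳ (sumTo-reverse n f) ⟩
    sumTo n (λ k → f (n ∸ k)) + f (suc n)  ≈⟨ +-comm _ _ ⟩
    f (suc n) + sumTo n (λ k → f (n ∸ k))  ≈⟨ sumTo-sucˡ n (λ k → f (suc n ∸ k)) ⟨
    sumTo (suc n) (λ k → f (suc n ∸ k))    ∎
    where open ≈-Reasoning

  sumTo-extend : ∀ {n N} (f : ℕ → Carrier) → n ≤ N → (∀ k → n < k → f k ≈ 0#) → sumTo N f ≈ sumTo n f
  sumTo-extend {N = zero}  f z≤n f≈0 = refl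
  sumTo-extend {N = suc N} f n≤1+N f≈0 with ℕ.m≤n⇒m<n∨m≡n n≤1+N
  ... | inj₂ ≡.refl     = refl
  ... | inj₁ (s≤s n≤N) = trans (+-cong (sumTo-extend f n≤N f≈0) (f≈0 (suc N) (s≤s n≤N))) (+-identityʳ _)

  sumTo-dropˡ : ∀ j m (f : ℕ → Carrier) → (∀ k → k < j → f k ≈ 0#) →
                sumTo (j ℕ.+ m) f ≈ sumTo m (λ l → f (j ℕ.+ l))
  sumTo-dropˡ zero    m f f≈0 = refl
  sumTo-dropˡ (suc j) m f f≈0 = begin
    sumTo (suc (j ℕ.+ m)) f                   ≈⟨ sumTo-sucˡ (j ℕ.+ m) f ⟩
    f 0 + sumTo (j ℕ.+ m) (λ k → f (suc k))   ≈⟨ +-cong (f≈0 0 (s≤s z≤n))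
                                                  (sumTo-dropˡ j m (λ k → f (suc k)) (λ k k<j → f≈0 (suc k) (s≤s k<j))) ⟩
    0# + sumTo m (λ l → f (suc (j ℕ.+ l)))    ≈⟨ +-identityˡ _ ⟩
    sumTo m (λ l → f (suc j ℕ.+ l))           ∎
    where open ≈-Reasoning

  sumTo-swap : ∀ n N (f : ℕ → ℕ → Carrier) →
               sumTo n (λ k → sumTo N (λ m → f k m)) ≈ sumTo N (λ m → sumTo n (λ k → f k m))
  sumTo-swap zero    N f = refl
  sumTo-swap (suc n) N f = trans (+-congʳ (sumTo-swap n N f)) (sym (sumTo-+ N _ _))

  sumTo-telescope : ∀ n (f : ℕ → Carrier) → sumTo n (λ m → f m - f (suc m)) ≈ f 0 - f (suc n)
  sumTo-telescope zero    f = refl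
  sumTo-telescope (suc n) f = trans (+-congʳ (sumTo-telescope n f)) (telescope _ _ _)
    where
    telescope : ∀ x y z → (x - y) + (y - z) ≈ x - z
    telescope = solve 3 (λ x y z → (x :- y) :+ (y :- z) := x :- z) refl

  infix 4 _≋_
  _≋_ : PS → PS → Set ℓ
  f ≋ g = ∀ n → f n ≈ g n

  neg : PS → PS
  neg f n = - f n

  const-0# : ∀ n → const 0# n ≈ 0#
  const-0# zero    = refl
  const-0# (suc n) = refl

  ⊛-cong : ∀ {f f′ g g′} → f ≋ f′ → g ≋ g′ → f ⊛ g ≋ f′ ⊛ g′
  ⊛-cong f≋f′ g≋g′ n = sumTo-cong n (λ k → *-cong (f≋f′ k) (g≋g′ (n ∸ k)))

  ⊛-congˡ : ∀ f {g g′} → g ≋ g′ → f ⊛ g ≋ f ⊛ g′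
  ⊛-congˡ f g≋g′ = ⊛-cong {f} {f} (λ n → refl) g≋g′

  ⊛-congʳ : ∀ g {f f′} → f ≋ f′ → f ⊛ g ≋ f′ ⊛ g
  ⊛-congʳ g f≋f′ = ⊛-cong {g = g} {g} f≋f′ (λ n → refl)

  ⊛-comm : ∀ (f g : PS) → f ⊛ g ≋ g ⊛ f
  ⊛-comm f g n = begin
    sumTo n (λ k → f k * g (n ∸ k))              ≈⟨ sumTo-reverse n _ ⟩
    sumTo n (λ k → f (n ∸ k) * g (n ∸ (n ∸ k)))  ≈⟨ sumTo-cong≤ n (λ k k≤n →
                                                     trans (*-comm _ _) (*-congʳ (≡⇒≈ (≡.cong g (ℕ.m∸[m∸n]≡n k≤n))))) ⟩
    sumTo n (λ k → g k * f (n ∸ k))              ∎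
    where open ≈-Reasoning

  ⊛-identityˡ : ∀ (g : PS) → const 1# ⊛ g ≋ g
  ⊛-identityˡ g zero    = *-identityˡ _
  ⊛-identityˡ g (suc n) = begin
    sumTo (suc n) (λ k → const 1# k * g (suc n ∸ k))  ≈⟨ sumTo-sucˡ n _ ⟩
    1# * g (suc n) + sumTo n (λ k → 0# * g (n ∸ k))   ≈⟨ +-cong (*-identityˡ _) (sumTo-zero n _ (λ k _ → zeroˡ _)) ⟩
    g (suc n) + 0#                                    ≈⟨ +-identityʳ _ ⟩
    g (suc n)                                         ∎
    where open ≈-Reasoning

  ⊛-distribˡ : ∀ (f g h : PS) → f ⊛ (g ⊕ h) ≋ (f ⊛ g) ⊕ (f ⊛ h)
  ⊛-distribˡ f g h n = trans (sumTo-cong n (λ k → distribˡ _ _ _)) (sumTo-+ n _ _)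

  ⊛-distribʳ : ∀ (f g h : PS) → (f ⊕ g) ⊛ h ≋ (f ⊛ h) ⊕ (g ⊛ h)
  ⊛-distribʳ f g h n = trans (sumTo-cong n (λ k → distribʳ _ _ _)) (sumTo-+ n _ _)

  shiftedCoeff : PS → ℕ → ℕ → Carrier
  shiftedCoeff g j k with j ℕ.≤? k
  ... | yes _ = g (k ∸ j)
  ... | no _  = 0#

  shiftedCoeff-≤ : ∀ g {j k} → j ≤ k → shiftedCoeff g j k ≈ g (k ∸ j)
  shiftedCoeff-≤ g {j} {k} j≤k with j ℕ.≤? k
  ... | yes _  = refl
  ... | no j≰k = ⊥-elim (j≰k j≤k)

  shiftedCoeff-> : ∀ g {j k} → k < j → shiftedCoeff g j k ≈ 0#
  shiftedCoeff-> g {j} {k} k<j with j ℕ.≤? k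
  ... | yes j≤k = ⊥-elim (ℕ.<⇒≱ k<j j≤k)
  ... | no _    = refl

  ⊛-coeff-extend : ∀ (f g : PS) {k n} → k ≤ n →
                   (f ⊛ g) k ≈ sumTo n (λ j → f j * shiftedCoeff g j k)
  ⊛-coeff-extend f g {k} {n} k≤n = begin
    sumTo k (λ j → f j * g (k ∸ j))             ≈⟨ sumTo-cong≤ k (λ j j≤k → *-congˡ (sym (shiftedCoeff-≤ g j≤k))) ⟩
    sumTo k (λ j → f j * shiftedCoeff g j k)    ≈⟨ sumTo-extend _ k≤n (λ j k<j → trans (*-congˡ (shiftedCoeff-> g k<j)) (zeroʳ _)) ⟨
    sumTo n (λ j → f j * shiftedCoeff g j k)    ∎
    where open ≈-Reasoning

  ⊛-assoc : ∀ (f g h : PS) → (f ⊛ g) ⊛ h ≋ f ⊛ (g ⊛ h)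
  ⊛-assoc f g h n = begin
    sumTo n (λ k → (f ⊛ g) k * h (n ∸ k))
      ≈⟨ sumTo-cong≤ n (λ k k≤n → *-congʳ (⊛-coeff-extend f g k≤n)) ⟩
    sumTo n (λ k → sumTo n (λ j → f j * shiftedCoeff g j k) * h (n ∸ k))
      ≈⟨ sumTo-cong n (λ k → trans (sym (sumTo-*ʳ n _ _)) (sumTo-cong n (λ j → *-assoc _ _ _))) ⟩
    sumTo n (λ k → sumTo n (λ j → f j * (shiftedCoeff g j k * h (n ∸ k))))
      ≈⟨ sumTo-swap n n _ ⟩
    sumTo n (λ j → sumTo n (λ k → f j * (shiftedCoeff g j k * h (n ∸ k))))
      ≈⟨ sumTo-cong≤ n (λ j j≤n → trans (sumTo-*ˡ n _ _) (*-congˡ (inner j≤n))) ⟩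
    sumTo n (λ j → f j * (g ⊛ h) (n ∸ j))
      ∎
    where
    open ≈-Reasoning
    inner : ∀ {j} → j ≤ n → sumTo n (λ k → shiftedCoeff g j k * h (n ∸ k)) ≈ (g ⊛ h) (n ∸ j)
    inner {j} j≤n = begin
      sumTo n (λ k → shiftedCoeff g j k * h (n ∸ k))
        ≡⟨ ≡.cong (λ m → sumTo m (λ k → shiftedCoeff g j k * h (n ∸ k))) (ℕ.m+[n∸m]≡n j≤n) ⟨
      sumTo (j ℕ.+ (n ∸ j)) (λ k → shiftedCoeff g j k * h (n ∸ k))
        ≈⟨ sumTo-dropˡ j (n ∸ j) _ (λ k k<j → trans (*-congʳ (shiftedCoeff-> g k<j)) (zeroˡ _)) ⟩
      sumTo (n ∸ j) (λ l → shiftedCoeff g j (j ℕ.+ l) * h (n ∸ (j ℕ.+ l)))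
        ≈⟨ sumTo-cong (n ∸ j) (λ l → *-cong (trans (shiftedCoeff-≤ g (ℕ.m≤m+n j l)) (≡⇒≈ (≡.cong g (ℕ.m+n∸m≡n j l))))
                                            (≡⇒≈ (≡.cong h (≡.sym (ℕ.∸-+-assoc n j l))))) ⟩
      sumTo (n ∸ j) (λ l → g l * h (n ∸ j ∸ l))
        ∎

  powerSeriesRing : CommutativeRing c ℓ
  powerSeriesRing = record
    { Carrier = PS ; _≈_ = _≋_ ; _+_ = _⊕_ ; _*_ = _⊛_ ; -_ = neg ; 0# = const 0# ; 1# = const 1#
    ; isCommutativeRing = record
      { isRing = record
        { +-isAbelianGroup = record
          { isGroup = record
            { isMonoid = record
              { isSemigroup = record
                { isMagma = record
                  { isEquivalence = record
                    { refl = λ n → refl ; sym = λ e n → sym (e n) ; trans = λ e e′ n → trans (e n) (e′ n) }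
                  ; ∙-cong = λ e e′ n → +-cong (e n) (e′ n) }
                ; assoc = λ f g h n → +-assoc _ _ _ }
              ; identity = (λ f n → trans (+-congʳ (const-0# n)) (+-identityˡ _))
                         , (λ f n → trans (+-congˡ (const-0# n)) (+-identityʳ _)) }
            ; inverse = (λ f n → trans (-‿inverseˡ _) (sym (const-0# n)))
                      , (λ f n → trans (-‿inverseʳ _) (sym (const-0# n)))
            ; ⁻¹-cong = λ e n → -‿cong (e n) }
          ; comm = λ f g n → +-comm _ _ }
        ; *-cong = ⊛-cong
        ; *-assoc = ⊛-assoc
        ; *-identity = ⊛-identityˡ , (λ g n → trans (⊛-comm g (const 1#) n) (⊛-identityˡ g n))
        ; distrib = ⊛-distribˡ , (λ h f g → ⊛-distribʳ f g h) }
      ; *-comm = ⊛-comm } }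

  module PS = CommutativeRing powerSeriesRing
  module PSSolver = IntegerCoefficientSolver powerSeriesRing
  module ≋-Reasoning = Relation.Binary.Reasoning.Setoid PS.setoid

  private
    ∸-suc-< : ∀ {j k m} → suc k ≤ j → j < suc m → j ∸ suc k < m
    ∸-suc-< {suc j} {k} _ (s≤s j<m) = ℕ.≤-<-trans (ℕ.m∸n≤m j k) j<m

  powPS-order : ∀ (h : PS) → h 0 ≈ 0# → ∀ m {j} → j < m → powPS h m j ≈ 0#
  powPS-order h h₀≈0 (suc m) {j} j<1+m = sumTo-zero j _ term
    where
    term : ∀ k → k ≤ j → h k * powPS h m (j ∸ k) ≈ 0#
    term zero    _     = trans (*-congʳ h₀≈0) (zeroˡ _)
    term (suc k) 1+k≤j = trans (*-congˡ (powPS-order h h₀≈0 m (∸-suc-< 1+k≤j j<1+m))) (zeroʳ _)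

  1⊖f-order : ∀ (f : PS) → f 0 ≈ 1# → (const 1# ⊖ f) 0 ≈ 0#
  1⊖f-order f f₀≈1 = trans (+-congˡ (-‿cong f₀≈1)) (-‿inverseʳ 1#)

  recip-truncate : ∀ (f : PS) → f 0 ≈ 1# → ∀ {n N} → n ≤ N →
                   recip f n ≈ sumTo N (λ m → powPS (const 1# ⊖ f) m n)
  recip-truncate f f₀≈1 n≤N =
    sym (sumTo-extend _ n≤N (λ m n<m → powPS-order (const 1# ⊖ f) (1⊖f-order f f₀≈1) m n<m))

  recip-inverseʳ : ∀ (f : PS) → f 0 ≈ 1# → f ⊛ recip f ≋ const 1#
  recip-inverseʳ f f₀≈1 n = begin
    sumTo n (λ k → f k * recip f (n ∸ k))
      ≈⟨ sumTo-cong n (λ k → *-congˡ (recip-truncate f f₀≈1 (ℕ.m∸n≤m n k))) ⟩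
    sumTo n (λ k → f k * sumTo n (λ m → powPS h m (n ∸ k)))
      ≈⟨ sumTo-cong n (λ k → sym (sumTo-*ˡ n _ _)) ⟩
    sumTo n (λ k → sumTo n (λ m → f k * powPS h m (n ∸ k)))
      ≈⟨ sumTo-swap n n _ ⟩
    sumTo n (λ m → (f ⊛ powPS h m) n)
      ≈⟨ sumTo-cong n (λ m → f≈1-[1-f] f (powPS h m) n) ⟩
    sumTo n (λ m → powPS h m n - powPS h (suc m) n)
      ≈⟨ sumTo-telescope n (λ m → powPS h m n) ⟩
    const 1# n - powPS h (suc n) n
      ≈⟨ +-congˡ (trans (-‿cong (powPS-order h (1⊖f-order f f₀≈1) (suc n) ℕ.≤-refl)) -0#≈0#) ⟩
    const 1# n + 0#
      ≈⟨ +-identityʳ _ ⟩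
    const 1# n
      ∎
    where
    open ≈-Reasoning
    open PSSolver using () renaming (solve to solveₚ; _:*_ to _⊠_; _:-_ to _⊟_; _:=_ to _≐_; :1 to ①)
    h : PS
    h = const 1# ⊖ f
    f≈1-[1-f] : ∀ f g → f ⊛ g ≋ g ⊖ ((const 1# ⊖ f) ⊛ g)
    f≈1-[1-f] = solveₚ 2 (λ f g → f ⊠ g ≐ g ⊟ (① ⊟ f) ⊠ g) PS.refl

  recip-inverseˡ : ∀ (f : PS) → f 0 ≈ 1# → recip f ⊛ f ≋ const 1#
  recip-inverseˡ f f₀≈1 n = trans (⊛-comm (recip f) f n) (recip-inverseʳ f f₀≈1 n)

  recip-cancelˡ : ∀ (f g : PS) → f 0 ≈ 1# → recip f ⊛ (f ⊛ g) ≋ g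
  recip-cancelˡ f g f₀≈1 = begin
    recip f ⊛ (f ⊛ g)  ≈⟨ PS.*-assoc (recip f) f g ⟨
    (recip f ⊛ f) ⊛ g  ≈⟨ ⊛-congʳ g (recip-inverseˡ f f₀≈1) ⟩
    const 1# ⊛ g       ≈⟨ ⊛-identityˡ g ⟩
    g                  ∎
    where open ≋-Reasoning

  recip-cancelʳ : ∀ (f g : PS) → f 0 ≈ 1# → (g ⊛ recip f) ⊛ f ≋ g
  recip-cancelʳ f g f₀≈1 = begin
    (g ⊛ recip f) ⊛ f  ≈⟨ PS.*-assoc g (recip f) f ⟩
    g ⊛ (recip f ⊛ f)  ≈⟨ ⊛-congˡ g (recip-inverseˡ f f₀≈1) ⟩
    g ⊛ const 1#       ≈⟨ PS.*-identityʳ g ⟩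
    g                  ∎
    where open ≋-Reasoning

  ⊛-cancelˡ : ∀ (f : PS) {g h} → f 0 ≈ 1# → f ⊛ g ≋ f ⊛ h → g ≋ h
  ⊛-cancelˡ f {g} {h} f₀≈1 fg≋fh = begin
    g                  ≈⟨ recip-cancelˡ f g f₀≈1 ⟨
    recip f ⊛ (f ⊛ g)  ≈⟨ ⊛-congˡ (recip f) fg≋fh ⟩
    recip f ⊛ (f ⊛ h)  ≈⟨ recip-cancelˡ f h f₀≈1 ⟩
    h                  ∎
    where open ≋-Reasoning

  recip-unique : ∀ (f g : PS) → f 0 ≈ 1# → f ⊛ g ≋ const 1# → g ≋ recip f
  recip-unique f g f₀≈1 fg≋1 = ⊛-cancelˡ f f₀≈1 (λ n → trans (fg≋1 n) (sym (recip-inverseʳ f f₀≈1 n)))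

  recip-of-⊛ : ∀ (f g h : PS) → f 0 ≈ 1# → h 0 ≈ 1# → f ⊛ g ≋ h → recip f ≋ g ⊛ recip h
  recip-of-⊛ f g h f₀≈1 h₀≈1 fg≋h = PS.sym (recip-unique f (g ⊛ recip h) f₀≈1 (begin
    f ⊛ (g ⊛ recip h)  ≈⟨ PS.*-assoc f g (recip h) ⟨
    (f ⊛ g) ⊛ recip h  ≈⟨ ⊛-congʳ (recip h) fg≋h ⟩
    h ⊛ recip h        ≈⟨ recip-inverseʳ h h₀≈1 ⟩
    const 1#           ∎))
    where open ≋-Reasoning

  AgreeBelow : ℕ → PS → PS → Set ℓ
  AgreeBelow d f g = ∀ n → n < d → f n ≈ g n

  ⊛-agreeBelow : ∀ d {f f′ g g′ : PS} → AgreeBelow d f f′ → AgreeBelow d g g′ → AgreeBelow d (f ⊛ g) (f′ ⊛ g′)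
  ⊛-agreeBelow d f≈f′ g≈g′ n n<d = sumTo-cong≤ n (λ k k≤n →
    *-cong (f≈f′ k (ℕ.≤-<-trans k≤n n<d)) (g≈g′ (n ∸ k) (ℕ.≤-<-trans (ℕ.m∸n≤m n k) n<d)))

  powPS-agreeBelow : ∀ d {h h′ : PS} → AgreeBelow d h h′ → ∀ m → AgreeBelow d (powPS h m) (powPS h′ m)
  powPS-agreeBelow d h≈h′ zero    n _ = refl
  powPS-agreeBelow d h≈h′ (suc m) = ⊛-agreeBelow d h≈h′ (powPS-agreeBelow d h≈h′ m)

  recip-agreeBelow : ∀ d {f g : PS} → AgreeBelow d f g → AgreeBelow d (recip f) (recip g)
  recip-agreeBelow d f≈g n n<d = sumTo-cong n (λ m →
    powPS-agreeBelow d (λ j j<d → +-congˡ (-‿cong (f≈g j j<d))) m n n<d)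

  ⊛-agreeBelow-suc : ∀ d (w : PS) → w 0 ≈ 0# → ∀ {f g : PS} → AgreeBelow d f g → AgreeBelow (suc d) (w ⊛ f) (w ⊛ g)
  ⊛-agreeBelow-suc d w w₀≈0 {f} {g} f≈g n n<1+d = sumTo-cong≤ n term
    where
    term : ∀ k → k ≤ n → w k * f (n ∸ k) ≈ w k * g (n ∸ k)
    term zero    _     = trans (*-congʳ w₀≈0) (trans (zeroˡ _) (sym (trans (*-congʳ w₀≈0) (zeroˡ _))))
    term (suc k) 1+k≤n = *-congˡ (f≈g (n ∸ suc k) (∸-suc-< 1+k≤n n<1+d))

  -- J-fractions from three-term recurrences

  shift-cong : ∀ {f g : PS} → f ≋ g → shift f ≋ shift g
  shift-cong f≋g zero    = refl
  shift-cong f≋g (suc n) = f≋g n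

  shift-⊛ : ∀ (f g : PS) → shift f ⊛ g ≋ shift (f ⊛ g)
  shift-⊛ f g zero    = zeroˡ _
  shift-⊛ f g (suc n) = trans (sumTo-sucˡ n _) (trans (+-congʳ (zeroˡ _)) (+-identityˡ _))

  const-⊛ : ∀ x (g : PS) → const x ⊛ g ≋ scale x g
  const-⊛ x g zero    = refl
  const-⊛ x g (suc n) =
    trans (sumTo-sucˡ n _) (trans (+-congˡ (sumTo-zero n _ (λ k _ → zeroˡ _))) (+-identityʳ _))

  shift-const-⊛ : ∀ x (g : PS) → shift (const x) ⊛ g ≋ shift (scale x g)
  shift-const-⊛ x g n = trans (shift-⊛ (const x) g n) (shift-cong (const-⊛ x g) n)

  module JFraction (b a lam : ℕ → Carrier) where

    numerator : ℕ → PS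
    numerator k = shift (const (a (suc k))) ⊕ shift (shift (const (lam (suc k))))

    -- cfApprox (suc d) b a lam k unfolds to recip (denominator k (cfApprox d b a lam (suc k)))
    denominator : ℕ → PS → PS
    denominator k f = const 1# ⊖ (shift (const (b k)) ⊕ (numerator k ⊛ f))

    ThreeTermRecurrence : (ℕ → PS) → Set ℓ
    ThreeTermRecurrence P = ∀ k →
      P k ≋ P (suc k) ⊖ ((shift (const (b k)) ⊛ P (suc k)) ⊕ (numerator k ⊛ P (suc (suc k))))

    threeTermRecurrence-coeffs : ∀ (P : ℕ → PS) →
      (∀ k → P k 0 ≈ P (suc k) 0) →
      (∀ k → P k 1 ≈ P (suc k) 1 - (b k * P (suc k) 0 + a (suc k) * P (suc (suc k)) 0)) →
      (∀ k n → P k (suc (suc n)) ≈ P (suc k) (suc (suc n))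
                 - (b k * P (suc k) (suc n) + (a (suc k) * P (suc (suc k)) (suc n) + lam (suc k) * P (suc (suc k)) n))) →
      ThreeTermRecurrence P
    threeTermRecurrence-coeffs P c₀ c₁ c₂ k n =
      trans (coefficient n) (+-congˡ (-‿cong (sym (+-cong (shift-const-⊛ (b k) P₁ n) numerator-⊛))))
      where
      P₁ P₂ : PS
      P₁ = P (suc k)
      P₂ = P (suc (suc k))
      numerator-⊛ : (numerator k ⊛ P₂) n ≈ shift (scale (a (suc k)) P₂) n + shift (shift (scale (lam (suc k)) P₂)) n
      numerator-⊛ = trans (⊛-distribʳ (shift (const (a (suc k)))) (shift (shift (const (lam (suc k))))) P₂ n)
        (+-cong (shift-const-⊛ (a (suc k)) P₂ n)
                (trans (shift-⊛ (shift (const (lam (suc k)))) P₂ n) (shift-cong (shift-const-⊛ (lam (suc k)) P₂) n)))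
      coefficient : ∀ n → P k n ≈ P₁ n - (shift (scale (b k) P₁) n
                                        + (shift (scale (a (suc k)) P₂) n + shift (shift (scale (lam (suc k)) P₂)) n))
      coefficient zero          = trans (c₀ k) (sym (trans (+-congˡ (trans (-‿cong 0+[0+0]≈0) -0#≈0#)) (+-identityʳ _)))
        where
        0+[0+0]≈0 : 0# + (0# + 0#) ≈ 0#
        0+[0+0]≈0 = trans (+-identityˡ _) (+-identityʳ 0#)
      coefficient (suc zero)    = trans (c₁ k) (+-congˡ (-‿cong (+-congˡ (sym (+-identityʳ _)))))
      coefficient (suc (suc n)) = c₂ k n

    numerator₀≈0 : ∀ k → numerator k 0 ≈ 0#
    numerator₀≈0 k = +-identityʳ 0#

    denominator₀≈1 : ∀ k f → denominator k f 0 ≈ 1#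
    denominator₀≈1 k f = begin
      1# - (0# + numerator k 0 * f 0)  ≈⟨ +-congˡ (-‿cong (+-congˡ (trans (*-congʳ (numerator₀≈0 k)) (zeroˡ _)))) ⟩
      1# - (0# + 0#)                   ≈⟨ +-congˡ (trans (-‿cong (+-identityʳ 0#)) -0#≈0#) ⟩
      1# + 0#                          ≈⟨ +-identityʳ 1# ⟩
      1#                               ∎
      where open ≈-Reasoning

    module _ (P : ℕ → PS) (P₀≈1 : ∀ k → P k 0 ≈ 1#) (recurrence : ThreeTermRecurrence P) where

      ratio : ℕ → PS
      ratio k = P (suc k) ⊛ recip (P k)

      denominator-ratio-⊛ : ∀ k → denominator k (ratio (suc k)) ⊛ P (suc k) ≋ P k
      denominator-ratio-⊛ k = begin
        (const 1# ⊖ (V ⊕ (W ⊛ G))) ⊛ P₁       ≈⟨ expand V W G P₁ ⟩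
        P₁ ⊖ ((V ⊛ P₁) ⊕ (W ⊛ (G ⊛ P₁)))    ≈⟨ (λ n → +-congˡ (-‿cong (+-congˡ (⊛-congˡ W G⊛P₁≋P₂ n)))) ⟩
        P₁ ⊖ ((V ⊛ P₁) ⊕ (W ⊛ P (suc (suc k)))) ≈⟨ PS.sym (recurrence k) ⟩
        P k                                   ∎
        where
        open ≋-Reasoning
        open PSSolver using () renaming (solve to solveₚ; _:*_ to _⊠_; _:-_ to _⊟_; _:+_ to _⊞_; _:=_ to _≐_; :1 to ①)
        V W G P₁ : PS
        V = shift (const (b k))
        W = numerator k
        G = ratio (suc k)
        P₁ = P (suc k)
        G⊛P₁≋P₂ : G ⊛ P₁ ≋ P (suc (suc k))
        G⊛P₁≋P₂ = recip-cancelʳ P₁ (P (suc (suc k))) (P₀≈1 (suc k))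
        expand : ∀ V W G P₁ → (const 1# ⊖ (V ⊕ (W ⊛ G))) ⊛ P₁ ≋ P₁ ⊖ ((V ⊛ P₁) ⊕ (W ⊛ (G ⊛ P₁)))
        expand = solveₚ 4 (λ V W G P₁ → (① ⊟ (V ⊞ W ⊠ G)) ⊠ P₁ ≐ P₁ ⊟ (V ⊠ P₁ ⊞ W ⊠ (G ⊠ P₁))) PS.refl

      recip-denominator-ratio : ∀ k → recip (denominator k (ratio (suc k))) ≋ ratio k
      recip-denominator-ratio k =
        recip-of-⊛ (denominator k (ratio (suc k))) (P (suc k)) (P k) (denominator₀≈1 k (ratio (suc k))) (P₀≈1 k) (denominator-ratio-⊛ k)

      cfApprox-agreeBelow : ∀ d k → AgreeBelow d (cfApprox d b a lam k) (ratio k)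
      cfApprox-agreeBelow zero    k n ()
      cfApprox-agreeBelow (suc d) k n n<1+d = trans
        (recip-agreeBelow (suc d) (λ m m<1+d → +-congˡ (-‿cong (+-congˡ
          (⊛-agreeBelow-suc d (numerator k) (numerator₀≈0 k) (cfApprox-agreeBelow d (suc k)) m m<1+d)))) n n<1+d)
        (recip-denominator-ratio k n)

      μ≈ratio : ∀ n → μ b a lam n ≈ ratio 0 n
      μ≈ratio n = cfApprox-agreeBelow (suc n) 0 n ℕ.≤-refl

  -- Substituting t² for t

  double : ℕ → ℕ
  double zero    = 0
  double (suc n) = suc (suc (double n))

  double≡2* : ∀ n → double n ≡ 2 ℕ.* n
  double≡2* zero    = ≡.refl
  double≡2* (suc n) = ≡.cong suc (≡.trans (≡.cong suc (double≡2* n)) (≡.sym (ℕ.+-suc n (n ℕ.+ 0))))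

  data Parity : ℕ → Set where
    even : ∀ n → Parity (double n)
    odd  : ∀ n → Parity (suc (double n))

  parity : ∀ m → Parity m
  parity zero = even 0
  parity (suc m) with parity m
  ... | even n = odd n
  ... | odd n  = even (suc n)

  evenOdd-double : ∀ {a} {A : Set a} (e o : ℕ → A) n → evenOdd e o (double n) ≡ e n
  evenOdd-double e o zero    = ≡.refl
  evenOdd-double e o (suc n) = evenOdd-double (λ i → e (suc i)) (λ i → o (suc i)) n

  evenOdd-suc-double : ∀ {a} {A : Set a} (e o : ℕ → A) n → evenOdd e o (suc (double n)) ≡ o n
  evenOdd-suc-double e o zero    = ≡.refl
  evenOdd-suc-double e o (suc n) = evenOdd-suc-double (λ i → e (suc i)) (λ i → o (suc i)) n

  spread-double : ∀ (f : PS) n → spread f (double n) ≈ f n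
  spread-double f n = ≡⇒≈ (evenOdd-double f (λ _ → 0#) n)

  spread-suc-double : ∀ (f : PS) n → spread f (suc (double n)) ≈ 0#
  spread-suc-double f n = ≡⇒≈ (evenOdd-suc-double f (λ _ → 0#) n)

  spread-cong : ∀ {f g : PS} → f ≋ g → spread f ≋ spread g
  spread-cong {f} {g} f≋g m with parity m
  ... | even n = trans (spread-double f n) (trans (f≋g n) (sym (spread-double g n)))
  ... | odd n  = trans (spread-suc-double f n) (sym (spread-suc-double g n))

  sumTo-double : ∀ m (f : ℕ → Carrier) → (∀ j → f (suc (double j)) ≈ 0#) →
                 sumTo (double m) f ≈ sumTo m (λ j → f (double j))
  sumTo-suc-double : ∀ m (f : ℕ → Carrier) → (∀ j → f (suc (double j)) ≈ 0#) →
                     sumTo (suc (double m)) f ≈ sumTo m (λ j → f (double j))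
  sumTo-double zero    f odd≈0 = refl
  sumTo-double (suc m) f odd≈0 = +-congʳ (sumTo-suc-double m f odd≈0)
  sumTo-suc-double m f odd≈0 = trans (+-cong (sumTo-double m f odd≈0) (odd≈0 m)) (+-identityʳ _)

  double∸double : ∀ n j → double n ∸ double j ≡ double (n ∸ j)
  double∸double zero    zero    = ≡.refl
  double∸double zero    (suc j) = ≡.refl
  double∸double (suc n) zero    = ≡.refl
  double∸double (suc n) (suc j) = double∸double n j

  suc-double∸double : ∀ {n j} → j ≤ n → suc (double n) ∸ double j ≡ suc (double (n ∸ j))
  suc-double∸double {n}     {zero}  _         = ≡.refl
  suc-double∸double {suc n} {suc j} (s≤s j≤n) = suc-double∸double j≤n

  spread-⊛ : ∀ (f g : PS) → spread (f ⊛ g) ≋ spread f ⊛ spread g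
  spread-⊛ f g m with parity m
  ... | even n = sym (begin
    sumTo (double n) (λ k → spread f k * spread g (double n ∸ k))
      ≈⟨ sumTo-double n _ (λ j → trans (*-congʳ (spread-suc-double f j)) (zeroˡ _)) ⟩
    sumTo n (λ j → spread f (double j) * spread g (double n ∸ double j))
      ≈⟨ sumTo-cong n (λ j → *-cong (spread-double f j)
                               (trans (≡⇒≈ (≡.cong (spread g) (double∸double n j))) (spread-double g (n ∸ j)))) ⟩
    sumTo n (λ j → f j * g (n ∸ j))
      ≈⟨ spread-double (f ⊛ g) n ⟨
    spread (f ⊛ g) (double n)
      ∎)
    where open ≈-Reasoning
  ... | odd n = trans (spread-suc-double (f ⊛ g) n) (sym (begin
    sumTo (suc (double n)) (λ k → spread f k * spread g (suc (double n) ∸ k))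
      ≈⟨ sumTo-suc-double n _ (λ j → trans (*-congʳ (spread-suc-double f j)) (zeroˡ _)) ⟩
    sumTo n (λ j → spread f (double j) * spread g (suc (double n) ∸ double j))
      ≈⟨ sumTo-zero n _ (λ j j≤n → trans (*-congˡ (trans (≡⇒≈ (≡.cong (spread g) (suc-double∸double j≤n)))
                                                          (spread-suc-double g (n ∸ j)))) (zeroʳ _)) ⟩
    0#
      ∎))
    where open ≈-Reasoning

  spread-const : ∀ x → spread (const x) ≋ const x
  spread-const x m with parity m
  ... | even zero    = refl
  ... | even (suc n) = spread-double (const x) (suc n)
  ... | odd n        = spread-suc-double (const x) n

  spread-recip : ∀ (f : PS) → f 0 ≈ 1# → spread (recip f) ≋ recip (spread f)
  spread-recip f f₀≈1 = recip-unique (spread f) (spread (recip f)) f₀≈1 (begin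
    spread f ⊛ spread (recip f)  ≈⟨ spread-⊛ f (recip f) ⟨
    spread (f ⊛ recip f)         ≈⟨ spread-cong (recip-inverseʳ f f₀≈1) ⟩
    spread (const 1#)            ≈⟨ spread-const 1# ⟩
    const 1#                     ∎)
    where open ≋-Reasoning

  spread-ratio : ∀ (f g : PS) → f 0 ≈ 1# → spread g ⊛ recip (spread f) ≋ spread (g ⊛ recip f)
  spread-ratio f g f₀≈1 = begin
    spread g ⊛ recip (spread f)   ≈⟨ ⊛-congˡ (spread g) (spread-recip f f₀≈1) ⟨
    spread g ⊛ spread (recip f)   ≈⟨ spread-⊛ g (recip f) ⟨
    spread (g ⊛ recip f)          ∎
    where open ≋-Reasoning

  -- An identity x ≈ y is proved from hypotheses eᵢ ≈ fᵢ by exhibiting x - y as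
  -- a combination Σ (eᵢ - fᵢ) * uᵢ (a ring identity, checked by the solver).
  ≈-by : ∀ {x y z} → x - y ≈ z → z ≈ 0# → x ≈ y
  ≈-by x-y≈z z≈0 = x∙y⁻¹≈ε⇒x≈y _ _ (trans x-y≈z z≈0)

  vanishing : ∀ {e f} u → e ≈ f → (e - f) * u ≈ 0#
  vanishing u e≈f = trans (*-congʳ (x≈y⇒x∙y⁻¹≈ε e≈f)) (zeroˡ u)

  infixl 6 _⊹_
  _⊹_ : ∀ {x y} → x ≈ 0# → y ≈ 0# → x + y ≈ 0#
  x≈0 ⊹ y≈0 = trans (+-cong x≈0 y≈0) (+-identityʳ 0#)

  1≉0 : ¬ (1# ≈ 0#)
  1≉0 1≈0 = 0≉1 (sym 1≈0)

  ⁻¹-unique : ∀ {x y} → ¬ (x ≈ 0#) → x * y ≈ 1# → y ≈ x ⁻¹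
  ⁻¹-unique {x} {y} x≉0 xy≈1 = begin
    y                ≈⟨ *-identityˡ y ⟨
    1# * y           ≈⟨ *-congʳ (trans (*-comm _ _) (⁻¹-inverse x x≉0)) ⟨
    (x ⁻¹ * x) * y   ≈⟨ *-assoc _ _ _ ⟩
    x ⁻¹ * (x * y)   ≈⟨ *-congˡ xy≈1 ⟩
    x ⁻¹ * 1#        ≈⟨ *-identityʳ _ ⟩
    x ⁻¹             ∎
    where open ≈-Reasoning

  1⁻¹≈1 : 1# ⁻¹ ≈ 1#
  1⁻¹≈1 = sym (⁻¹-unique 1≉0 (*-identityˡ 1#))

  *-nonzero : ∀ {x y} → ¬ (x ≈ 0#) → ¬ (y ≈ 0#) → ¬ (x * y ≈ 0#)
  *-nonzero {x} {y} x≉0 y≉0 xy≈0 = x≉0 (begin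
    x                ≈⟨ *-identityʳ x ⟨
    x * 1#           ≈⟨ *-congˡ (⁻¹-inverse y y≉0) ⟨
    x * (y * y ⁻¹)   ≈⟨ *-assoc _ _ _ ⟨
    (x * y) * y ⁻¹   ≈⟨ *-congʳ xy≈0 ⟩
    0# * y ⁻¹        ≈⟨ zeroˡ _ ⟩
    0#               ∎)
    where open ≈-Reasoning

  ⁻¹-factor : ∀ {a b c} → a ≈ b * c → ¬ (a ≈ 0#) → b ⁻¹ ≈ c * a ⁻¹
  ⁻¹-factor {a} {b} {c} a≈bc a≉0 = sym (⁻¹-unique b≉0 (begin
    b * (c * a ⁻¹)   ≈⟨ *-assoc _ _ _ ⟨
    (b * c) * a ⁻¹   ≈⟨ *-congʳ a≈bc ⟨
    a * a ⁻¹         ≈⟨ ⁻¹-inverse a a≉0 ⟩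
    1#               ∎))
    where
    open ≈-Reasoning
    b≉0 : ¬ (b ≈ 0#)
    b≉0 b≈0 = a≉0 (trans a≈bc (trans (*-congʳ b≈0) (zeroˡ c)))

  1-x≈0⇒x≈1 : ∀ {x} → 1# - x ≈ 0# → x ≈ 1#
  1-x≈0⇒x≈1 1-x≈0 = sym (x∙y⁻¹≈ε⇒x≈y _ _ 1-x≈0)

  ^-+ : ∀ x m n → x ^ (m ℕ.+ n) ≈ x ^ m * x ^ n
  ^-+ x zero    n = sym (*-identityˡ _)
  ^-+ x (suc m) n = trans (*-congˡ (^-+ x m n)) (sym (*-assoc _ _ _))

  ^-distrib-* : ∀ x y n → (x * y) ^ n ≈ x ^ n * y ^ n
  ^-distrib-* x y zero    = sym (*-identityˡ _)
  ^-distrib-* x y (suc n) = trans (*-congˡ (^-distrib-* x y n)) (interchange x y _ _)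
    where open import Algebra.Properties.CommutativeSemigroup *-commutativeSemigroup using (interchange)

  1^n≈1 : ∀ n → 1# ^ n ≈ 1#
  1^n≈1 zero    = refl
  1^n≈1 (suc n) = trans (*-identityˡ _) (1^n≈1 n)

  ^-congˡ : ∀ {x y} n → x ≈ y → x ^ n ≈ y ^ n
  ^-congˡ zero    x≈y = refl
  ^-congˡ (suc n) x≈y = *-cong x≈y (^-congˡ n x≈y)

  poch-nonzero : ∀ x y n → (∀ i → ¬ (1# - x * y ^ i ≈ 0#)) → ¬ (poch x y n ≈ 0#)
  poch-nonzero x y zero    factors≉0 = 1≉0
  poch-nonzero x y (suc n) factors≉0 = *-nonzero (poch-nonzero x y n factors≉0) (factors≉0 n)

  poch-suc-shift : ∀ x y m → poch x y (suc m) ≈ (1# - x) * poch (y * x) y m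
  poch-suc-shift x y zero    = solve 1 (λ x → :1 :* (:1 :- x :* :1) := (:1 :- x) :* :1) refl x
  poch-suc-shift x y (suc m) = trans (*-congʳ (poch-suc-shift x y m)) (reassoc x y (y ^ m) (poch (y * x) y m))
    where
    reassoc : ∀ x y w Q → ((1# - x) * Q) * (1# - x * (y * w)) ≈ (1# - x) * (Q * (1# - (y * x) * w))
    reassoc = solve 4 (λ x y w Q → ((:1 :- x) :* Q) :* (:1 :- x :* (y :* w))
                                  := (:1 :- x) :* (Q :* (:1 :- (y :* x) :* w))) refl

  -- Contiguous relations of the q-Bessel coefficients

  -- ΦCoeff p p S is the coefficient sequence of Φ with p^(ν+1) replaced by S; a
  -- general π rescales its variable by π/p.
  ΦCoeff : Carrier → Carrier → Carrier → ℕ → Carrier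
  ΦCoeff p π S n = ((- 1#) ^ n) * (p ^ (n C 2)) * (π ^ n) * (poch p p n ⁻¹) * (poch S p n ⁻¹)

  ΦCoeff-zero : ∀ p π S → ΦCoeff p π S 0 ≈ 1#
  ΦCoeff-zero p π S = trans (*-cong (*-cong (*-identityʳ _) 1⁻¹≈1) 1⁻¹≈1)
                            (trans (*-identityʳ _) (trans (*-identityʳ _) (*-identityʳ 1#)))

  module Contiguous (p S : Carrier) (n : ℕ)
                    (pp≉0 : ¬ (poch p p (suc n) ≈ 0#)) (Sp≉0 : ¬ (poch S p (suc (suc n)) ≈ 0#)) where

    private
      w σ β₂ X Z : Carrier
      w = p ^ n
      σ = (- 1#) ^ n
      β₂ = p ^ (n C 2)
      X = poch p p (suc n) ⁻¹
      Z = poch S p (suc (suc n)) ⁻¹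

      binomial-suc : p ^ (suc n C 2) ≈ β₂ * w
      binomial-suc = trans (≡⇒≈ (≡.cong (p ^_) suc-n-C-2)) (trans (^-+ p n (n C 2)) (*-comm _ _))
        where
        suc-n-C-2 : suc n C 2 ≡ n ℕ.+ n C 2
        suc-n-C-2 = ≡.trans (≡.sym (nCk+nC[k+1]≡[n+1]C[k+1] n 1)) (≡.cong (ℕ._+ n C 2) (nC1≡n n))

      X-pred : poch p p n ⁻¹ ≈ (1# - p * w) * X
      X-pred = ⁻¹-factor refl pp≉0

      Z-pred : poch S p (suc n) ⁻¹ ≈ (1# - S * (p * w)) * Z
      Z-pred = ⁻¹-factor refl Sp≉0

      Z-shift : poch (p * S) p (suc n) ⁻¹ ≈ (1# - S) * Z
      Z-shift = ⁻¹-factor (trans (poch-suc-shift S p (suc n)) (*-comm _ _)) Sp≉0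

      Z-pred-shift : poch (p * S) p n ⁻¹ ≈ ((1# - S) * (1# - S * (p * w))) * Z
      Z-pred-shift = ⁻¹-factor (trans (*-congʳ (poch-suc-shift S p n)) (reassoc _ _ _)) Sp≉0
        where
        reassoc : ∀ a Q e → (a * Q) * e ≈ Q * (a * e)
        reassoc = solve 3 (λ a Q e → (a :* Q) :* e := Q :* (a :* e)) refl

      Z-pred-shift² : poch (p * (p * S)) p n ⁻¹ ≈ ((1# - S) * (1# - p * S)) * Z
      Z-pred-shift² = ⁻¹-factor (trans (poch-suc-shift S p (suc n))
                                  (trans (*-congˡ (poch-suc-shift (p * S) p n)) (reassoc _ _ _))) Sp≉0
        where
        reassoc : ∀ a e Q → a * (e * Q) ≈ Q * (a * e)
        reassoc = solve 3 (λ a e Q → a :* (e :* Q) := Q :* (a :* e)) refl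

    -- every coefficient below is this common factor times a polynomial
    common : Carrier → Carrier
    common π = σ * β₂ * π ^ n * X * Z

    common-scale : ∀ π → common (p * π) ≈ w * common π
    common-scale π = trans (*-congʳ (*-congʳ (*-congˡ (^-distrib-* p π n)))) (reassoc σ β₂ w (π ^ n) X Z)
      where
      reassoc : ∀ σ β w ρ X Z → σ * β * (w * ρ) * X * Z ≈ w * (σ * β * ρ * X * Z)
      reassoc = solve 6 (λ σ β w ρ X Z → σ :* β :* (w :* ρ) :* X :* Z := w :* (σ :* β :* ρ :* X :* Z)) refl

    coeff-suc : ∀ π → ΦCoeff p π S (suc n) ≈ common π * (- (w * π) * (1# - S * (p * w)))
    coeff-suc π = trans (*-cong (*-congʳ (*-congʳ (*-congˡ binomial-suc))) Z-pred)
      (solve 9 (λ σ β w π ρ X S p Z →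
         :- :1 :* σ :* (β :* w) :* (π :* ρ) :* X :* ((:1 :- S :* (p :* w)) :* Z)
           := σ :* β :* ρ :* X :* Z :* (:- (w :* π) :* (:1 :- S :* (p :* w)))) refl σ β₂ w π (π ^ n) X S p Z)

    coeff-shift-suc : ∀ π → ΦCoeff p π (p * S) (suc n) ≈ common π * (- (w * π) * (1# - S))
    coeff-shift-suc π = trans (*-cong (*-congʳ (*-congʳ (*-congˡ binomial-suc))) Z-shift)
      (solve 8 (λ σ β w π ρ X S Z →
         :- :1 :* σ :* (β :* w) :* (π :* ρ) :* X :* ((:1 :- S) :* Z)
           := σ :* β :* ρ :* X :* Z :* (:- (w :* π) :* (:1 :- S))) refl σ β₂ w π (π ^ n) X S Z)

    coeff-shift : ∀ π → ΦCoeff p π (p * S) n ≈ common π * ((1# - p * w) * ((1# - S) * (1# - S * (p * w))))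
    coeff-shift π = trans (*-cong (*-congˡ X-pred) Z-pred-shift)
      (solve 8 (λ σ β ρ X S p w Z →
         σ :* β :* ρ :* ((:1 :- p :* w) :* X) :* (((:1 :- S) :* (:1 :- S :* (p :* w))) :* Z)
           := σ :* β :* ρ :* X :* Z :* ((:1 :- p :* w) :* ((:1 :- S) :* (:1 :- S :* (p :* w))))) refl
         σ β₂ (π ^ n) X S p w Z)

    coeff-shift² : ∀ π → ΦCoeff p π (p * (p * S)) n ≈ common π * ((1# - p * w) * ((1# - S) * (1# - p * S)))
    coeff-shift² π = trans (*-cong (*-congˡ X-pred) Z-pred-shift²)
      (solve 8 (λ σ β ρ X S p w Z →
         σ :* β :* ρ :* ((:1 :- p :* w) :* X) :* (((:1 :- S) :* (:1 :- p :* S)) :* Z)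
           := σ :* β :* ρ :* X :* Z :* ((:1 :- p :* w) :* ((:1 :- S) :* (:1 :- p :* S)))) refl
         σ β₂ (π ^ n) X S p w Z)

    relation-b-a : ∀ {β α} → β * (1# - S) ≈ - 1# → α * ((1# - S) * (1# - p * S)) ≈ 1# →
      ΦCoeff p p S (suc n) ≈ ΦCoeff p p (p * S) (suc n) - (β * ΦCoeff p p (p * S) n + α * ΦCoeff p p (p * (p * S)) n)
    relation-b-a {β} {α} hβ hα = ≈-by
      (trans (+-cong (coeff-suc p) (-‿cong (+-cong (coeff-shift-suc p)
                     (-‿cong (+-cong (*-congˡ (coeff-shift p)) (*-congˡ (coeff-shift² p)))))))
             (solve 6 (λ C w p S β α →
               C :* (:- (w :* p) :* (:1 :- S :* (p :* w)))
                 :- (C :* (:- (w :* p) :* (:1 :- S))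
                     :- (β :* (C :* ((:1 :- p :* w) :* ((:1 :- S) :* (:1 :- S :* (p :* w)))))
                         :+ α :* (C :* ((:1 :- p :* w) :* ((:1 :- S) :* (:1 :- p :* S))))))
               := (β :* (:1 :- S) :- :- :1) :* (C :* (:1 :- p :* w) :* (:1 :- S :* (p :* w)))
                  :+ (α :* ((:1 :- S) :* (:1 :- p :* S)) :- :1) :* (C :* (:1 :- p :* w))) refl
               (common p) w p S β α))
      (vanishing _ hβ ⊹ vanishing _ hα)

    relation-λ-even : ∀ {π λ′} → λ′ * ((1# - S) * (1# - p * S)) ≈ π * S →
      ΦCoeff p π S (suc n) ≈ ΦCoeff p π (p * S) (suc n) - λ′ * ΦCoeff p (p * π) (p * (p * S)) n
    relation-λ-even {π} {λ′} hλ = ≈-by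
      (trans (+-cong (coeff-suc π) (-‿cong (+-cong (coeff-shift-suc π)
                     (-‿cong (*-congˡ (trans (coeff-shift² (p * π)) (*-congʳ (common-scale π))))))))
             (solve 6 (λ C w p S π λ′ →
               C :* (:- (w :* π) :* (:1 :- S :* (p :* w)))
                 :- (C :* (:- (w :* π) :* (:1 :- S))
                     :- λ′ :* (w :* C :* ((:1 :- p :* w) :* ((:1 :- S) :* (:1 :- p :* S)))))
               := (λ′ :* ((:1 :- S) :* (:1 :- p :* S)) :- π :* S) :* (C :* w :* (:1 :- p :* w))) refl
               (common π) w p S π λ′))
      (vanishing _ hλ)

    relation-λ-odd : ∀ {π λ′} → λ′ * ((1# - S) * (1# - p * S)) ≈ π →
      ΦCoeff p π S (suc n) ≈ ΦCoeff p (p * π) (p * S) (suc n) - λ′ * ΦCoeff p (p * π) (p * (p * S)) n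
    relation-λ-odd {π} {λ′} hλ = ≈-by
      (trans (+-cong (coeff-suc π) (-‿cong (+-cong (trans (coeff-shift-suc (p * π)) (*-congʳ (common-scale π)))
                     (-‿cong (*-congˡ (trans (coeff-shift² (p * π)) (*-congʳ (common-scale π))))))))
             (solve 6 (λ C w p S π λ′ →
               C :* (:- (w :* π) :* (:1 :- S :* (p :* w)))
                 :- (w :* C :* (:- (w :* (p :* π)) :* (:1 :- S))
                     :- λ′ :* (w :* C :* ((:1 :- p :* w) :* ((:1 :- S) :* (:1 :- p :* S)))))
               := (λ′ :* ((:1 :- S) :* (:1 :- p :* S)) :- π) :* (C :* w :* (:1 :- p :* w))) refl
               (common π) w p S π λ′))
      (vanishing _ hλ)

  -- The Hahn–Exton J-fractions

  module HahnExtonJFractions (q r : Carrier) (q≉0 : ¬ (q ≈ 0#)) (r≉0 : ¬ (r ≈ 0#))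
                             (q^k≉1 : ∀ k → ¬ (q ^ suc k ≈ 1#)) (q^kr≉1 : ∀ k → ¬ ((q ^ suc k) * r ≈ 1#)) where
    open HahnExton q r

    -- s k = p^(ν+1+k)
    s : ℕ → Carrier
    s zero    = pν1
    s (suc k) = p * s k

    q*p≈1 : q * p ≈ 1#
    q*p≈1 = ⁻¹-inverse q q≉0

    qr*pν1≈1 : (q * r) * pν1 ≈ 1#
    qr*pν1≈1 = ⁻¹-inverse (q * r) (*-nonzero q≉0 r≉0)

    qν*s≈1 : ∀ k → qν (suc k) * s k ≈ 1#
    qν*s≈1 zero    = trans (*-congʳ (*-congʳ (*-identityʳ q))) qr*pν1≈1
    qν*s≈1 (suc k) = begin
      ((q * q ^ suc k) * r) * (p * s k)   ≈⟨ reassoc q (q ^ suc k) r p (s k) ⟩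
      (q * p) * ((q ^ suc k * r) * s k)   ≈⟨ *-cong q*p≈1 (qν*s≈1 k) ⟩
      1# * 1#                             ≈⟨ *-identityˡ 1# ⟩
      1#                                  ∎
      where
      open ≈-Reasoning
      reassoc : ∀ q Q r p S → ((q * Q) * r) * (p * S) ≈ (q * p) * ((Q * r) * S)
      reassoc = solve 5 (λ q Q r p S → ((q :* Q) :* r) :* (p :* S) := (q :* p) :* ((Q :* r) :* S)) refl

    1-qν≉0 : ∀ k → ¬ (1# - qν (suc k) ≈ 0#)
    1-qν≉0 k 1-qν≈0 = q^kr≉1 k (1-x≈0⇒x≈1 1-qν≈0)

    1-s≉0 : ∀ k → ¬ (1# - s k ≈ 0#)
    1-s≉0 k 1-s≈0 = q^kr≉1 k (trans (sym (*-identityʳ _)) (trans (*-congˡ (sym (1-x≈0⇒x≈1 1-s≈0))) (qν*s≈1 k)))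

    s*p^i : ∀ k i → s k * p ^ i ≈ s (i ℕ.+ k)
    s*p^i k zero    = *-identityʳ _
    s*p^i k (suc i) = trans (x[yz]≈y[xz] (s k) p (p ^ i)) (*-congˡ (s*p^i k i))
      where
      x[yz]≈y[xz] : ∀ x y z → x * (y * z) ≈ y * (x * z)
      x[yz]≈y[xz] = solve 3 (λ x y z → x :* (y :* z) := y :* (x :* z)) refl

    poch-s≉0 : ∀ k n → ¬ (poch (s k) p n ≈ 0#)
    poch-s≉0 k n = poch-nonzero (s k) p n (λ i 1-sp^i≈0 →
      1-s≉0 (i ℕ.+ k) (trans (+-congˡ (-‿cong (sym (s*p^i k i)))) 1-sp^i≈0))

    p^k≉1 : ∀ k → ¬ (p ^ suc k ≈ 1#)
    p^k≉1 k p^k≈1 = q^k≉1 k (begin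
      q ^ suc k                  ≈⟨ *-identityʳ _ ⟨
      q ^ suc k * 1#             ≈⟨ *-congˡ p^k≈1 ⟨
      q ^ suc k * p ^ suc k      ≈⟨ ^-distrib-* q p (suc k) ⟨
      (q * p) ^ suc k            ≈⟨ ^-congˡ (suc k) q*p≈1 ⟩
      1# ^ suc k                 ≈⟨ 1^n≈1 (suc k) ⟩
      1#                         ∎)
      where open ≈-Reasoning

    poch-p≉0 : ∀ n → ¬ (poch p p n ≈ 0#)
    poch-p≉0 n = poch-nonzero p p n (λ i 1-p^i≈0 → p^k≉1 i (1-x≈0⇒x≈1 1-p^i≈0))

    module ContiguousAt (k n : ℕ) = Contiguous p (s k) n (poch-p≉0 (suc n)) (poch-s≉0 k (suc (suc n)))

    b*[1-s]≈-1 : ∀ k → b k * (1# - s k) ≈ - 1#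
    b*[1-s]≈-1 k = ≈-by
      (solve 3 (λ u S I → u :* I :* (:1 :- S) :- :- :1
                         := (u :* S :- :1) :* (:- I) :+ ((:1 :- u) :* I :- :1) :* (:- :1)) refl
         (qν (suc k)) (s k) ((1# - qν (suc k)) ⁻¹))
      (vanishing _ (qν*s≈1 k) ⊹ vanishing _ (⁻¹-inverse _ (1-qν≉0 k)))

    a*[1-s][1-ps]≈1 : ∀ k → a (suc k) * ((1# - s k) * (1# - p * s k)) ≈ 1#
    a*[1-s][1-ps]≈1 k = ≈-by
      (trans (+-congʳ (*-congʳ (*-congʳ (*-congˡ (^-+ q (suc (suc k)) (suc k))))))
        (solve 6 (λ r Q₁ Q₂ S p D →
           r :* r :* (Q₂ :* Q₁) :* D :* ((:1 :- S) :* (:1 :- p :* S)) :- :1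
             := (Q₁ :* r :* S :- :1) :* (:- (D :* (Q₂ :* r) :* (:1 :- p :* S)))
                :+ (Q₂ :* r :* (p :* S) :- :1) :* (D :* (:1 :- Q₁ :* r))
                :+ ((:1 :- Q₁ :* r) :* (:1 :- Q₂ :* r) :* D :- :1) :* :1) refl
           r (q ^ suc k) (q ^ suc (suc k)) (s k) p D))
      (vanishing _ (qν*s≈1 k) ⊹ vanishing _ (qν*s≈1 (suc k))
         ⊹ vanishing _ (⁻¹-inverse _ (*-nonzero (1-qν≉0 k) (1-qν≉0 (suc k)))))
      where
      D : Carrier
      D = ((1# - qν (suc k)) * (1# - qν (suc (suc k)))) ⁻¹

    -- scaling k = p^(⌊k/2⌋+1): the variable rescaling of the series behind the even
    -- part of the J-fraction.
    scaling : ℕ → Carrier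
    scaling zero          = p
    scaling (suc zero)    = p
    scaling (suc (suc k)) = p * scaling k

    scaling-suc-double : ∀ i → scaling (suc (double i)) ≡ scaling (double i)
    scaling-suc-double zero    = ≡.refl
    scaling-suc-double (suc i) = ≡.cong (p *_) (scaling-suc-double i)

    r*q^i*ps≈scaling : ∀ i → r * q ^ suc i * (p * s (double i)) ≈ scaling (double i)
    r*q^i*ps≈scaling zero    = trans (reassoc r q p pν1) (trans (*-congˡ qr*pν1≈1) (*-identityʳ p))
      where
      reassoc : ∀ r q p X → r * (q * 1#) * (p * X) ≈ p * ((q * r) * X)
      reassoc = solve 4 (λ r q p X → r :* (q :* :1) :* (p :* X) := p :* ((q :* r) :* X)) refl
    r*q^i*ps≈scaling (suc i) = begin
      r * (q * q ^ suc i) * (p * (p * (p * s (double i))))   ≈⟨ reassoc r q (q ^ suc i) p (s (double i)) ⟩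
      ((q * p) * p) * (r * q ^ suc i * (p * s (double i)))   ≈⟨ *-cong (*-congʳ q*p≈1) (r*q^i*ps≈scaling i) ⟩
      (1# * p) * scaling (double i)                          ≈⟨ *-congʳ (*-identityˡ p) ⟩
      p * scaling (double i)                                 ∎
      where
      open ≈-Reasoning
      reassoc : ∀ r q Q p S → r * (q * Q) * (p * (p * (p * S))) ≈ ((q * p) * p) * (r * Q * (p * S))
      reassoc = solve 5 (λ r q Q p S → r :* (q :* Q) :* (p :* (p :* (p :* S)))
                                     := ((q :* p) :* p) :* (r :* Q :* (p :* S))) refl

    lam′-suc-double : ∀ i → lam' (suc (double i))
      ≈ r * q ^ suc i * ((1# - qν (suc (double i))) * (1# - qν (suc (suc (double i))))) ⁻¹
    lam′-suc-double i = ≡⇒≈ (≡.trans (evenOdd-suc-double _ _ i)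
      (≡.cong (λ j → r * q ^ suc i * ((1# - qν (suc j)) * (1# - qν (suc (suc j)))) ⁻¹) (≡.sym (double≡2* i))))

    lam′-double-suc : ∀ i → lam' (double (suc i))
      ≈ (r * r) * (q ^ suc i * q ^ suc (suc (suc (double i))))
          * ((1# - qν (suc (suc (double i)))) * (1# - qν (suc (suc (suc (double i)))))) ⁻¹
    lam′-double-suc i = trans
      (≡⇒≈ (≡.trans (evenOdd-double
        (λ i → (r * r) * q ^ suc (3 ℕ.* i) * ((1# - qν (2 ℕ.* i)) * (1# - qν (suc (2 ℕ.* i)))) ⁻¹)
        (λ i → r * q ^ suc i * ((1# - qν (suc (2 ℕ.* i))) * (1# - qν (suc (suc (2 ℕ.* i))))) ⁻¹) (suc i))
        (≡.cong (λ j → (r * r) * q ^ suc (3 ℕ.* suc i) * ((1# - qν j) * (1# - qν (suc j))) ⁻¹)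
                (≡.sym (double≡2* (suc i))))))
      (*-congʳ (*-congˡ (trans (≡⇒≈ (≡.cong (q ^_) exponent)) (^-+ q (suc i) _))))
      where
      exponent : suc (3 ℕ.* suc i) ≡ suc i ℕ.+ suc (suc (suc (double i)))
      exponent = ≡.trans (arithmetic i) (≡.cong (λ j → suc i ℕ.+ suc (suc (suc j))) (≡.sym (double≡2* i)))
        where
        open import Data.Nat.Tactic.RingSolver using (solve-∀)
        arithmetic : ∀ i → suc (3 ℕ.* suc i) ≡ suc i ℕ.+ suc (suc (suc (2 ℕ.* i)))
        arithmetic = solve-∀

    lam′-odd-identity : ∀ i → lam' (suc (double i)) * ((1# - s (double i)) * (1# - p * s (double i)))
                                ≈ scaling (double i) * s (double i)
    lam′-odd-identity i = ≈-by
      (trans (+-congʳ (*-congʳ (lam′-suc-double i)))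
        (solve 7 (λ RQ D S p A B π →
           RQ :* D :* ((:1 :- S) :* (:1 :- p :* S)) :- π :* S
             := (A :* S :- :1) :* (RQ :* D :* (p :* S :- :1))
                :+ (B :* (p :* S) :- :1) :* (RQ :* D :* S :* (:1 :- A))
                :+ ((:1 :- A) :* (:1 :- B) :* D :- :1) :* (RQ :* S :* (p :* S))
                :+ (RQ :* (p :* S) :- π) :* S) refl
           (r * q ^ suc i) D (s (double i)) p (qν (suc (double i))) (qν (suc (suc (double i)))) (scaling (double i))))
      (vanishing _ (qν*s≈1 (double i)) ⊹ vanishing _ (qν*s≈1 (suc (double i)))
         ⊹ vanishing _ (⁻¹-inverse _ (*-nonzero (1-qν≉0 (double i)) (1-qν≉0 (suc (double i)))))
         ⊹ vanishing _ (r*q^i*ps≈scaling i))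
      where
      D : Carrier
      D = ((1# - qν (suc (double i))) * (1# - qν (suc (suc (double i))))) ⁻¹

    lam′-even-identity : ∀ i → lam' (suc (suc (double i))) * ((1# - s (suc (double i))) * (1# - p * s (suc (double i))))
                                 ≈ scaling (suc (double i))
    lam′-even-identity i = trans (≈-by
      (trans (+-congʳ (*-congʳ (lam′-double-suc i)))
        (solve 8 (λ r Q₁ Q₃ D S p A π →
           r :* r :* (Q₁ :* Q₃) :* D :* ((:1 :- S) :* (:1 :- p :* S)) :- π
             := (A :* S :- :1) :* (r :* Q₁ :* (Q₃ :* r) :* D :* (p :* S :- :1))
                :+ (Q₃ :* r :* (p :* S) :- :1) :* (π :+ r :* Q₁ :* (Q₃ :* r) :* D :* S :* (:1 :- A))
                :+ ((:1 :- A) :* (:1 :- Q₃ :* r) :* D :- :1) :* (π :* (Q₃ :* r :* (p :* S)))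
                :+ (r :* Q₁ :* S :- π) :* (Q₃ :* r :* (p :* S) :* ((:1 :- A) :* (:1 :- Q₃ :* r) :* D))) refl
           r (q ^ suc i) (q ^ suc (suc (suc (double i)))) D (s (suc (double i))) p (qν (suc (suc (double i))))
           (scaling (double i))))
      (vanishing _ (qν*s≈1 (suc (double i))) ⊹ vanishing _ (qν*s≈1 (suc (suc (double i))))
         ⊹ vanishing _ (⁻¹-inverse _ (*-nonzero (1-qν≉0 (suc (double i))) (1-qν≉0 (suc (suc (double i))))))
         ⊹ vanishing _ (r*q^i*ps≈scaling i)))
      (≡⇒≈ (≡.sym (scaling-suc-double i)))
      where
      D : Carrier
      D = ((1# - qν (suc (suc (double i)))) * (1# - qν (suc (suc (suc (double i)))))) ⁻¹

    module J-b-a = JFraction b a lam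
    module J-λ = JFraction b' a' lam'

    Φₛ : ℕ → PS
    Φₛ k = ΦCoeff p p (s k)

    recurrence-b-a : J-b-a.ThreeTermRecurrence Φₛ
    recurrence-b-a = J-b-a.threeTermRecurrence-coeffs Φₛ
      (λ k → trans (ΦCoeff-zero p p (s k)) (sym (ΦCoeff-zero p p (s (suc k)))))
      (λ k → ContiguousAt.relation-b-a k 0 (b*[1-s]≈-1 k) (a*[1-s][1-ps]≈1 k))
      (λ k n → trans (ContiguousAt.relation-b-a k (suc n) (b*[1-s]≈-1 k) (a*[1-s][1-ps]≈1 k))
        (+-congˡ (-‿cong (+-congˡ (sym (trans (+-congˡ (zeroˡ _)) (+-identityʳ _)))))))

    Φₛ-scaled : ℕ → PS
    Φₛ-scaled k = ΦCoeff p (scaling k) (s k)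

    relation-λ : ∀ k n → Φₛ-scaled k (suc n) ≈ Φₛ-scaled (suc k) (suc n) - lam' (suc k) * Φₛ-scaled (suc (suc k)) n
    relation-λ k n with parity k
    ... | even i = trans
      (ContiguousAt.relation-λ-even (double i) n (lam′-odd-identity i))
      (+-congʳ (≡⇒≈ (≡.cong (λ π → ΦCoeff p π (s (suc (double i))) (suc n)) (≡.sym (scaling-suc-double i)))))
    ... | odd i = trans
      (ContiguousAt.relation-λ-odd (suc (double i)) n (lam′-even-identity i))
      (+-congʳ (≡⇒≈ (≡.cong (λ π → ΦCoeff p (p * π) (s (suc (suc (double i)))) (suc n)) (scaling-suc-double i))))

    Ψ : ℕ → PS
    Ψ k = spread (Φₛ-scaled k)

    recurrence-λ : J-λ.ThreeTermRecurrence Ψ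
    recurrence-λ = J-λ.threeTermRecurrence-coeffs Ψ
      (λ k → trans (ΦCoeff-zero p (scaling k) (s k)) (sym (ΦCoeff-zero p (scaling (suc k)) (s (suc k)))))
      (λ k → solve 2 (λ x y → :0 := :0 :- (:0 :* x :+ :0 :* y)) refl _ _)
      coefficients
      where
      zero-terms : ∀ x y z → 0# * x + (0# * y + z) ≈ z
      zero-terms = solve 3 (λ x y z → :0 :* x :+ (:0 :* y :+ z) := z) refl
      coefficients : ∀ k m → Ψ k (suc (suc m))
        ≈ Ψ (suc k) (suc (suc m)) - (0# * Ψ (suc k) (suc m) + (0# * Ψ (suc (suc k)) (suc m) + lam' (suc k) * Ψ (suc (suc k)) m))
      coefficients k m with parity m
      ... | even n = trans (spread-double (Φₛ-scaled k) (suc n)) (trans (relation-λ k n)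
          (sym (+-cong (spread-double (Φₛ-scaled (suc k)) (suc n))
                       (-‿cong (trans (zero-terms _ _ _) (*-congˡ (spread-double (Φₛ-scaled (suc (suc k))) n)))))))
      ... | odd n = trans (spread-suc-double (Φₛ-scaled k) (suc n)) (sym (begin
          Ψ (suc k) (suc (double (suc n))) - (0# * _ + (0# * _ + lam' (suc k) * Ψ (suc (suc k)) (suc (double n))))
            ≈⟨ +-cong (spread-suc-double (Φₛ-scaled (suc k)) (suc n))
                      (-‿cong (trans (zero-terms _ _ _) (trans (*-congˡ (spread-suc-double (Φₛ-scaled (suc (suc k))) n)) (zeroʳ _)))) ⟩
          0# - 0#
            ≈⟨ -‿inverseʳ 0# ⟩
          0# ∎))
        where open ≈-Reasoning

    μ≈Φₛ-ratio : ∀ n → μ b a lam n ≈ (Φₛ 1 ⊛ recip (Φₛ 0)) n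
    μ≈Φₛ-ratio = J-b-a.μ≈ratio Φₛ (λ k → ΦCoeff-zero p p (s k)) recurrence-b-a

    μ′≈Ψ-ratio : ∀ n → μ b' a' lam' n ≈ (Ψ 1 ⊛ recip (Ψ 0)) n
    μ′≈Ψ-ratio = J-λ.μ≈ratio Ψ (λ k → ΦCoeff-zero p (scaling k) (s k)) recurrence-λ

    μ≈μ′-even : ∀ n → μ b a lam n ≈ μ b' a' lam' (2 ℕ.* n)
    μ≈μ′-even n = begin
      μ b a lam n
        ≈⟨ μ≈Φₛ-ratio n ⟩
      (Φₛ 1 ⊛ recip (Φₛ 0)) n
        ≈⟨ spread-double (Φₛ 1 ⊛ recip (Φₛ 0)) n ⟨
      spread (Φₛ 1 ⊛ recip (Φₛ 0)) (double n)
        ≈⟨ spread-ratio (Φₛ 0) (Φₛ 1) (ΦCoeff-zero p p pν1) (double n) ⟨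
      (spread (Φₛ 1) ⊛ recip (spread (Φₛ 0))) (double n)
        ≈⟨ μ′≈Ψ-ratio (double n) ⟨
      μ b' a' lam' (double n)
        ≡⟨ ≡.cong (μ b' a' lam') (double≡2* n) ⟩
      μ b' a' lam' (2 ℕ.* n)
        ∎
      where open ≈-Reasoning

    prefactor : (1# - pν1) ⁻¹ ≈ (q * r) * ((q * r) - 1#) ⁻¹
    prefactor = sym (⁻¹-unique (1-s≉0 0) (begin
      (1# - pν1) * ((q * r) * ((q * r) - 1#) ⁻¹) ≈⟨ *-assoc _ _ _ ⟨
      ((1# - pν1) * (q * r)) * ((q * r) - 1#) ⁻¹ ≈⟨ *-congʳ ([1-x]y≈y-1 pν1 (q * r) qr*pν1≈1) ⟩
      ((q * r) - 1#) * ((q * r) - 1#) ⁻¹         ≈⟨ ⁻¹-inverse _ qr-1≉0 ⟩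
      1#                                         ∎))
      where
      open ≈-Reasoning
      [1-x]y≈y-1 : ∀ x y → y * x ≈ 1# → (1# - x) * y ≈ y - 1#
      [1-x]y≈y-1 x y yx≈1 = ≈-by (solve 2 (λ x y → (:1 :- x) :* y :- (y :- :1) := (y :* x :- :1) :* (:- :1)) refl x y)
                                 (vanishing _ yx≈1)
      qr-1≉0 : ¬ ((q * r) - 1# ≈ 0#)
      qr-1≉0 qr-1≈0 = q^kr≉1 0 (trans (*-congʳ (*-identityʳ q)) (x∙y⁻¹≈ε⇒x≈y _ _ qr-1≈0))

    jRatio≈rhs : ∀ m → JRatio m ≈ rhs (μ b a lam) m
    jRatio≈rhs m = *-cong prefactor (shift-cong (PS.trans
      (spread-ratio (Φₛ 0) (Φₛ 1) (ΦCoeff-zero p p pν1))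
      (spread-cong (λ n → sym (μ≈Φₛ-ratio n)))) m)

    rhs-μ≈rhs-μ′ : ∀ m → rhs (μ b a lam) m ≈ rhs (λ n → μ b' a' lam' (2 ℕ.* n)) m
    rhs-μ≈rhs-μ′ m = *-congˡ (shift-cong (spread-cong μ≈μ′-even) m)

theorem6p5 : ∀ {c ℓ} (F : Field c ℓ) →
    let open Field F
        open Setup F
    in (q r : Carrier) →
       ¬ (q ≈ 0#) → ¬ (r ≈ 0#) →
       (∀ k → ¬ (q ^ suc k ≈ 1#)) →
       (∀ k → ¬ ((q ^ suc k) * r ≈ 1#)) →
       let open HahnExton q r
       in (∀ m → JRatio m ≈ rhs (μ b a lam) m)
          × (∀ m → rhs (μ b a lam) m ≈ rhs (λ n → μ b' a' lam' (2 Data.Nat.* n)) m)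
theorem6p5 F q r q≉0 r≉0 q^k≉1 q^kr≉1 = jRatio≈rhs , rhs-μ≈rhs-μ′
  where open HahnExtonJFractions F q r q≉0 r≉0 q^k≉1 q^kr≉1
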